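{- Let $\mathcal{S}=\langle\mathcal{L},\vdash\rangle$ be a structural logic, with $\mathcal{L}$ a formula algebra over a denumerable set of variables $V$. If there is no falsity constant for $\mathcal{S}$ in $\mathcal{L}$, then $\mathcal{S}^{pl}$ is NF-paraconsistent. Moreover, if in addition there exists $\varphi\in\mathcal{L}$ such that $\emptyset\not\vdash\varphi$, then $\mathcal{S}^{l}$ is also NF-paraconsistent.
   Context: A logic is a pair $\langle\mathcal{L},\vdash\rangle$ with $\vdash\,\subseteq\mathcal{P}(\mathcal{L})\times\mathcal{L}$, and $C_\vdash(\Gamma)=\{\alpha:\Gamma\vdash\alpha\}$. $\mathcal{L}$ is the formula algebra over a denumerable set $V$ of variables in a finite signature. A substitution is an endomorphism $\sigma$ of $\mathcal{L}$ (determined by any map $V\to\mathcal{L}$). $\mathcal{S}$ is structural if $\Gamma\vdash\varphi$ implies $\sigma(\Gamma)\vdash\sigma(\varphi)$ for every substitution $\sigma$. $\mathrm{var}(\alpha)$ is the set of variables in $\alpha$; $\mathrm{var}(\Delta)=\bigcup_{\alpha\in\Delta}\mathrm{var}(\alpha)$. A falsity constant is a constant $\bot\in\mathcal{L}$ (with $\mathrm{var}(\bot)=\emptyset$) such that $\{\bot\}\vdash\alpha$ for all $\alpha\in\mathcal{L}$. $\mathcal{S}^l=\langle\mathcal{L},\vdash^l\rangle$ where $\Gamma\vdash^l\alpha$ iff there is $\Delta\subseteq\Gamma$ with $\mathrm{var}(\Delta)\subseteq\mathrm{var}(\alpha)$ and $\Delta\vdash\alpha$; $\mathcal{S}^{pl}=\langle\mathcal{L},\vdash^{pl}\rangle$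 is defined the same way but requiring $\Delta\neq\emptyset$. A logic is NF-paraconsistent if there exists $\alpha\in\mathcal{L}$ such that $C_\vdash(\{\alpha,\beta\})\neq\mathcal{L}$ for every $\beta\in\mathcal{L}$. -}

module Defs where

open import Level using (Level; 0ℓ) renaming (suc to lsuc)
open import Data.Nat using (ℕ)
open import Data.Fin using (Fin)
open import Data.Vec using (Vec; []; _∷_)
open import Data.Product using (Σ; ∃; _×_; _,_)
open import Data.Sum using (_⊎_)
open import Data.Empty using (⊥)
open import Relation.Nullary using (¬_)
open import Relation.Unary using (Pred; _⊆_; _≐_; ∅)
open import Relation.Binary.PropositionalEquality using (_≡_)

record Signature : Set where
  field
    nOps  : ℕ
    arity : Fin nOps → ℕ
open Signature public

module _ (sig : Signature) where

  data Formula : Set where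
    var : ℕ → Formula
    op  : (f : Fin (nOps sig)) → Vec Formula (arity sig f) → Formula

  FSet : Set₁
  FSet = Pred Formula 0ℓ

module _ {sig : Signature} where

  mutual
    subst : (ℕ → Formula sig) → Formula sig → Formula sig
    subst s (var x)   = s x
    subst s (op f ts) = op f (substs s ts)

    substs : ∀ {n} → (ℕ → Formula sig) → Vec (Formula sig) n → Vec (Formula sig) n
    substs s []       = []
    substs s (t ∷ ts) = subst s t ∷ substs s ts

  mutual
    data Occurs (x : ℕ) : Formula sig → Set where
      here : Occurs x (var x)
      there : ∀ {f ts} → OccursV x ts → Occurs x (op f ts)

    data OccursV (x : ℕ) : ∀ {n} → Vec (Formula sig) n → Set where
      head : ∀ {n t} {ts : Vec (Formula sig) n} → Occurs x t → OccursV x (t ∷ ts)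
      tail : ∀ {n t} {ts : Vec (Formula sig) n} → OccursV x ts → OccursV x (t ∷ ts)

  OccursIn : ℕ → FSet sig → Set
  OccursIn x Δ = ∃ λ δ → Δ δ × Occurs x δ

  VarsSub : FSet sig → Formula sig → Set
  VarsSub Δ α = ∀ x → OccursIn x Δ → Occurs x α

  image : (ℕ → Formula sig) → FSet sig → FSet sig
  image s Γ φ = ∃ λ γ → Γ γ × subst s γ ≡ φ

  single : Formula sig → FSet sig
  single α φ = φ ≡ α

  pair : Formula sig → Formula sig → FSet sig
  pair α β φ = φ ≡ α ⊎ φ ≡ β

-- Sets of formulas are predicates; since sets are extensional, ⊢ is required
-- to respect extensional equality of sets (field `resp`).
record Logic (sig : Signature) (ℓ : Level) : Set (lsuc ℓ) where
  field
    _⊢_  : FSet sig → Formula sig → Set ℓ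
    resp : ∀ {Γ Γ' α} → Γ ≐ Γ' → Γ ⊢ α → Γ' ⊢ α
open Logic public

module _ {sig : Signature} {ℓ : Level} (S : Logic sig ℓ) where
  private _⊢S_ = _⊢_ S

  Structural : Set (lsuc 0ℓ Level.⊔ ℓ)
  Structural = ∀ (s : ℕ → Formula sig) Γ φ → Γ ⊢S φ → image s Γ ⊢S subst s φ

  IsFalsityConstant : Formula sig → Set ℓ
  IsFalsityConstant c = (∀ x → ¬ Occurs x c) × (∀ α → single c ⊢S α)

  HasFalsityConstant : Set ℓ
  HasFalsityConstant = ∃ λ c → IsFalsityConstant c

  _⊢l_ : FSet sig → Formula sig → Set (lsuc 0ℓ Level.⊔ ℓ)
  Γ ⊢l α = Σ (FSet sig) λ Δ → Δ ⊆ Γ × VarsSub Δ α × Δ ⊢S α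

  _⊢pl_ : FSet sig → Formula sig → Set (lsuc 0ℓ Level.⊔ ℓ)
  Γ ⊢pl α = Σ (FSet sig) λ Δ → Δ ⊆ Γ × (∃ λ δ → Δ δ) × VarsSub Δ α × Δ ⊢S α

-- NF-paraconsistency of a consequence relation:
-- ∃ α ∀ β, C({α,β}) ≠ L, i.e. not every formula follows from {α,β}.
NFParaconsistent : ∀ {sig ℓ} → (FSet sig → Formula sig → Set ℓ) → Set ℓ
NFParaconsistent {sig} _⊢'_ =
  ∃ λ (α : Formula sig) → ∀ β → ¬ (∀ γ → pair α β ⊢' γ)

{-# OPTIONS --safe #-}
module Submission where

open import Defs
open import Level using (Level)
open import Function using (const)
open import Data.Product using (_×_; ∃; _,_)
open import Data.Sum using (inj₁; inj₂)
open import Data.Empty using (⊥-elim)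
open import Data.Nat using (ℕ; suc; _≤_; _⊔_)
open import Data.Nat.Properties using (≤-refl; ≤-trans; m≤m⊔n; m≤n⊔m; n≮n)
open import Data.Vec using (Vec; []; _∷_)
open import Relation.Nullary using (¬_; yes; no)
open import Relation.Nullary.Decidable using (¬¬-excluded-middle)
open import Relation.Unary using (∅; _⊆_; _≐_)
open import Relation.Binary.PropositionalEquality using (_≡_; _≢_; refl; trans; cong; cong₂)
  renaming (subst to ≡-subst)

-- Fix a variable p. For any β choose a variable q ≠ p that does not occur in β.
-- A witness Δ ⊆ {p, β} for {p, β} ⊢ q with var(Δ) ⊆ {q} cannot contain p, so Δ ⊆ {β}
-- and β is closed. Substituting an arbitrary α for every variable then turns Δ ⊢ q into
-- {β} ⊢ α, making β a falsity constant, or, when Δ = ∅, into ∅ ⊢ α.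

module _ {sig : Signature} where

  Closed : Formula sig → Set
  Closed t = ∀ x → ¬ Occurs x t

  mutual
    maxVar : Formula sig → ℕ
    maxVar (var x)   = x
    maxVar (op f ts) = maxVarV ts

    maxVarV : ∀ {n} → Vec (Formula sig) n → ℕ
    maxVarV []       = 0
    maxVarV (t ∷ ts) = maxVar t ⊔ maxVarV ts

  mutual
    Occurs⇒≤maxVar : ∀ {x t} → Occurs x t → x ≤ maxVar t
    Occurs⇒≤maxVar here      = ≤-refl
    Occurs⇒≤maxVar (there o) = OccursV⇒≤maxVarV o

    OccursV⇒≤maxVarV : ∀ {x n} {ts : Vec (Formula sig) n} → OccursV x ts → x ≤ maxVarV ts
    OccursV⇒≤maxVarV (head {t = t} {ts} o) = ≤-trans (Occurs⇒≤maxVar o) (m≤m⊔n (maxVar t) (maxVarV ts))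
    OccursV⇒≤maxVarV (tail {t = t} {ts} o) = ≤-trans (OccursV⇒≤maxVarV o) (m≤n⊔m (maxVar t) (maxVarV ts))

  fresh : Formula sig → ℕ
  fresh t = suc (maxVar t)

  fresh-∉ : ∀ t → ¬ Occurs (fresh t) t
  fresh-∉ t o = n≮n (maxVar t) (Occurs⇒≤maxVar o)

  Occurs-var⇒≡ : ∀ {x y} → Occurs {sig} x (var y) → x ≡ y
  Occurs-var⇒≡ here = refl

  mutual
    subst-closed : ∀ s t → Closed t → subst s t ≡ t
    subst-closed s (var x)   c = ⊥-elim (c x here)
    subst-closed s (op f ts) c = cong (op f) (substs-closed s ts (λ x o → c x (there o)))

    substs-closed : ∀ {n} s (ts : Vec (Formula sig) n) → (∀ x → ¬ OccursV x ts) → substs s ts ≡ ts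
    substs-closed s []       c = refl
    substs-closed s (t ∷ ts) c =
      cong₂ _∷_ (subst-closed s t (λ x o → c x (head o))) (substs-closed s ts (λ x o → c x (tail o)))

  module _ {Δ : FSet sig} {y : ℕ} (vs : VarsSub Δ (var y)) where

    VarsSub-var⇒∉ : ∀ {x} → x ≢ y → ¬ Δ (var x)
    VarsSub-var⇒∉ x≢y d = x≢y (Occurs-var⇒≡ (vs _ (var _ , d , here)))

    VarsSub-var⇒Closed : ∀ {β} → Δ β → ¬ Occurs y β → Closed β
    VarsSub-var⇒Closed d y∉β x o with Occurs-var⇒≡ (vs x (_ , d , o))
    ... | refl = y∉β o

  ⊆pair⇒⊆single : ∀ {Δ : FSet sig} {α β} → Δ ⊆ pair α β → ¬ Δ α → Δ ⊆ single β
  ⊆pair⇒⊆single Δ⊆ α∉Δ d with Δ⊆ d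
  ... | inj₁ refl = ⊥-elim (α∉Δ d)
  ... | inj₂ eq   = eq

  image-const-single : ∀ {Δ : FSet sig} {β} α → Closed β → Δ ⊆ single β → Δ β →
                       image (const α) Δ ≐ single β
  image-const-single α cβ Δ⊆ β∈Δ =
    (λ { (γ , d , refl) → trans (cong (subst (const α)) (Δ⊆ d)) (subst-closed _ _ cβ) }) ,
    (λ { refl → _ , β∈Δ , subst-closed _ _ cβ })

  image-empty : ∀ {Δ : FSet sig} s → Δ ⊆ ∅ → image s Δ ≐ ∅
  image-empty s Δ⊆∅ = (λ { (_ , d , _) → Δ⊆∅ d }) , λ ()

module _ {sig : Signature} {ℓ : Level} (S : Logic sig ℓ) (st : Structural S) where

  private
    _⊢S_ = _⊢_ S

  ⊢var⇒image-const⊢ : ∀ {Γ y} → Γ ⊢S var y → ∀ α → image (const α) Γ ⊢S α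
  ⊢var⇒image-const⊢ {Γ} {y} d α = st (const α) Γ (var y) d

  ⊢var⇒IsFalsityConstant : ∀ {Δ β y} → Closed β → Δ ⊆ single β → Δ β → Δ ⊢S var y →
                           IsFalsityConstant S β
  ⊢var⇒IsFalsityConstant cβ Δ⊆ β∈Δ d =
    cβ , λ α → resp S (image-const-single α cβ Δ⊆ β∈Δ) (⊢var⇒image-const⊢ d α)

  ⊢var⇒∅⊢ : ∀ {Δ y} → Δ ⊆ ∅ → Δ ⊢S var y → ∀ α → ∅ ⊢S α
  ⊢var⇒∅⊢ Δ⊆∅ d α = resp S (image-empty (const α) Δ⊆∅) (⊢var⇒image-const⊢ d α)

theorem2p19 : ∀ {ℓ : Level} (sig : Signature) (S : Logic sig ℓ)
              → Structural S
              → ¬ HasFalsityConstant S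
              → NFParaconsistent (_⊢pl_ S)
                × ((∃ λ φ → ¬ (_⊢_ S ∅ φ)) → NFParaconsistent (_⊢l_ S))
theorem2p19 sig S st noFalsity = (var 0 , pl) , λ (φ , ⊬φ) → var 0 , l φ ⊬φ
  where
  module Witness {β : Formula sig} {Δ : FSet sig} (Δ⊆ : Δ ⊆ pair (var 0) β)
                 (vs : VarsSub Δ (var (fresh β))) (d : _⊢_ S Δ (var (fresh β))) where
    Δ⊆β : Δ ⊆ single β
    Δ⊆β = ⊆pair⇒⊆single Δ⊆ (VarsSub-var⇒∉ vs λ ())

    ∈Δ⇒β∈Δ : ∀ {δ} → Δ δ → Δ β
    ∈Δ⇒β∈Δ δ∈Δ = ≡-subst Δ (Δ⊆β δ∈Δ) δ∈Δ

    β∉Δ : ¬ Δ β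
    β∉Δ β∈Δ = noFalsity (β , ⊢var⇒IsFalsityConstant S st
                               (VarsSub-var⇒Closed vs β∈Δ (fresh-∉ β)) Δ⊆β β∈Δ d)

  pl : ∀ β → ¬ (∀ γ → _⊢pl_ S (pair (var 0) β) γ)
  pl β ⊢all with ⊢all (var (fresh β))
  ... | Δ , Δ⊆ , (δ , δ∈Δ) , vs , d = β∉Δ (∈Δ⇒β∈Δ δ∈Δ)
    where open Witness Δ⊆ vs d

  l : ∀ φ → ¬ (_⊢_ S ∅ φ) → ∀ β → ¬ (∀ γ → _⊢l_ S (pair (var 0) β) γ)
  l φ ⊬φ β ⊢all with ⊢all (var (fresh β))
  -- Whether β ∈ Δ is undecided, but the goal is a negation, so excluded middle is available.
  ... | Δ , Δ⊆ , vs , d = ¬¬-excluded-middle λ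
    { (yes β∈Δ) → β∉Δ β∈Δ
    ; (no β∉Δ′) → ⊬φ (⊢var⇒∅⊢ S st (λ δ∈Δ → β∉Δ′ (∈Δ⇒β∈Δ δ∈Δ)) d φ) }
    where open Witness Δ⊆ vs d
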